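{- For all positive integers $s,t$, $\operatorname{th_{dim}}(K_{s,t})=s+t-1$.
   Context: $K_{s,t}$ is the complete bipartite graph with parts of sizes $s$ and $t$. $\operatorname{dist}(u,v)$ is the shortest-path distance. For a nonnegative integer $r$, $\operatorname{dist}_r(x,v)=\min(\operatorname{dist}(x,v),r+1)$. A set $S\subseteq V(G)$ is a distance-$r$ resolving set if for all distinct $x,y\in V(G)$ there is $v\in S$ with $\operatorname{dist}_r(v,x)\ne\operatorname{dist}_r(v,y)$. $\dim_r(G)$ is the minimum size of such a set and $\operatorname{th_{dim}}(G)=\min_{r\ge0}(r+\dim_r(G))$ over nonnegative integers $r$. -}

module Defs where

open import Data.Nat using (ℕ; zero; suc; _+_; _≤_)
open import Data.Bool using (Bool; true; false; _∧_; _∨_; not; if_then_else_)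
open import Data.Fin using (Fin; splitAt; _≟_)
open import Data.Fin.Subset using (Subset; _∈_; ∣_∣)
open import Data.Sum using (_⊎_; inj₁; inj₂)
open import Data.Product using (Σ; _×_; ∃)
open import Data.Bool.ListAction using (any)
open import Data.List using (allFin)
open import Relation.Nullary.Decidable using (⌊_⌋)
open import Relation.Binary.PropositionalEquality using (_≡_; _≢_)

Graph : ℕ → Set
Graph n = Fin n → Fin n → Bool

reach : ∀ {n} → Graph n → ℕ → Fin n → Fin n → Bool
reach G zero    x y = ⌊ x ≟ y ⌋
reach G (suc k) x y = reach G k x y ∨ any (λ z → reach G k x z ∧ G z y) (allFin _)

-- distR G r x y = min(dist(x,y), r+1): least k ≤ r with dist(x,y) ≤ k, else r+1.
-- (search from k = i upwards; i counts the steps already done, fuel the remaining ones)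
private
  search : ∀ {n} → Graph n → Fin n → Fin n → ℕ → ℕ → ℕ
  search G x y i zero       = i
  search G x y i (suc fuel) = if reach G i x y then i else search G x y (suc i) fuel

distR : ∀ {n} → Graph n → ℕ → Fin n → Fin n → ℕ
distR G r x y = search G x y 0 (suc r)

Resolving : ∀ {n} → Graph n → ℕ → Subset n → Set
Resolving {n} G r S =
  (x y : Fin n) → x ≢ y → Σ (Fin n) λ v → (v ∈ S) × (distR G r v x ≢ distR G r v y)

-- th_dim(G) = m, with the minimum over r ≥ 0 and resolving sets S of r + |S| unfolded.
ThDimIs : ∀ {n} → Graph n → ℕ → Set
ThDimIs {n} G m =
  (Σ ℕ λ r → Σ (Subset n) λ S → Resolving G r S × (r + ∣ S ∣ ≡ m))
  × ((r : ℕ) (S : Subset n) → Resolving G r S → m ≤ r + ∣ S ∣)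

-- The complete bipartite graph K_{s,t} on Fin (s + t): the first s vertices form
-- one part, the last t the other; two vertices are adjacent iff in different parts.
side : ∀ {s t} → Fin (s + t) → Bool
side {s} x with splitAt s x
... | inj₁ _ = true
... | inj₂ _ = false

K : (s t : ℕ) → Graph (s + t)
K s t x y = not (side {s} {t} x ≡ᵇ side {s} {t} y)
  where
    _≡ᵇ_ : Bool → Bool → Bool
    true  ≡ᵇ b = b
    false ≡ᵇ b = not b

{-# OPTIONS --safe #-}
-- Two vertices on the same side of K_{s,t} have the same neighbourhood, so every other vertex
-- sees them at the same distance; as K_{s,t} has diameter 2, this holds for the truncated
-- distances too. Hence for r ≥ 1 a distance-r resolving set omits at most one vertex per side,
-- giving r + |S| ≥ 1 + (s + t − 2). For r = 0 the truncated distance only tests equality, so a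
-- resolving set omits at most one vertex overall, and omitting exactly one vertex does resolve.
module Submission where

open import Defs
open import Data.Nat using (ℕ; _+_; _∸_; _≤_; suc; zero; z≤n; s≤s)
open import Data.Nat.Properties using (≤-pred; ≤-trans; m≤n+m; module ≤-Reasoning)
open import Data.Bool using (Bool; true; false; T; _∧_; _∨_)
open import Data.Bool.Properties using (T-∨; T-∧; T-≡; ¬-not) renaming (_≟_ to _≟ᵇ_)
open import Data.Bool.ListAction using (or)
open import Data.Fin as Fin using (Fin; _↑ʳ_; _≟_)
open import Data.Fin.Properties using (suc-injective; splitAt-↑ʳ)
open import Data.Fin.Subset using (Subset; inside; outside; ∣_∣; ⊤; _∈_)
open import Data.Fin.Subset.Properties using (∈⊤; ∣⊤∣≡n; drop-there; p⊆q⇒∣p∣≤∣q∣)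
open import Data.Vec using ([]; _∷_; there)
open import Data.List using (allFin)
open import Data.List.Properties using (map-cong)
open import Data.List.Relation.Unary.Any.Properties using (any⁺)
open import Data.List.Membership.Propositional using (lose)
open import Data.List.Membership.Propositional.Properties using (∈-allFin)
open import Data.Empty using (⊥; ⊥-elim)
open import Data.Sum as Sum using (_⊎_; inj₁; inj₂)
open import Data.Product using (Σ; _,_)
open import Relation.Nullary using (yes; no; contradiction)
open import Relation.Nullary.Decidable using (dec-false; isYes≗does; fromWitness)
open import Function.Base using (_∘_; case_of_)
open import Function.Bundles using (Equivalence)
open import Relation.Binary.PropositionalEquality using (_≡_; _≢_; refl; sym; trans; cong; cong₂; ≢-sym)

open Equivalence using (to; from)

module _ {n} (G : Graph n) where

  reach-refl : ∀ v → T (reach G 0 v v)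
  reach-refl v = fromWitness refl

  reach-zero-≢ : ∀ {v x} → v ≢ x → reach G 0 v x ≡ false
  reach-zero-≢ {v} {x} v≢x = trans (isYes≗does (v ≟ x)) (dec-false (v ≟ x) v≢x)

  reach-step : ∀ k v z x → T (reach G k v z) → T (G z x) → T (reach G (suc k) v x)
  reach-step k v z x v↝z zx = from T-∨ (inj₂ (any⁺ _ (lose (∈-allFin z) (from T-∧ (v↝z , zx)))))

  reach-mono-suc : ∀ k v x → T (reach G k v x) → T (reach G (suc k) v x)
  reach-mono-suc k v x v↝x = from T-∨ (inj₁ v↝x)

  reach-twins : ∀ {v x y} → (∀ z → G z x ≡ G z y) → v ≢ x → v ≢ y →
                ∀ k → reach G k v x ≡ reach G k v y
  reach-twins _ v≢x v≢y zero = trans (reach-zero-≢ v≢x) (sym (reach-zero-≢ v≢y))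
  reach-twins {v} twins v≢x v≢y (suc k) =
    cong₂ _∨_ (reach-twins twins v≢x v≢y k)
              (cong or (map-cong (λ z → cong (reach G k v z ∧_) (twins z)) (allFin n)))

  -- The search behind distR is private to Defs and can only be unfolded finitely often;
  -- dist(v,x) ≤ 2 bounds it.
  distR-cong : ∀ {v x y} → (∀ k → reach G k v x ≡ reach G k v y) → T (reach G 2 v x) →
               ∀ r → distR G r v x ≡ distR G r v y
  distR-cong same _ zero rewrite same 0 = refl
  distR-cong same _ (suc zero) rewrite same 1 | same 0 = refl
  distR-cong same v↝x (suc (suc r))
    rewrite to T-≡ v↝x | trans (sym (same 2)) (to T-≡ v↝x) | same 1 | same 0 = refl

  distR-zero-refl : ∀ v → distR G 0 v v ≡ 0
  distR-zero-refl v rewrite to T-≡ (reach-refl v) = refl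

  distR-zero-≢ : ∀ {v x} → v ≢ x → distR G 0 v x ≡ 1
  distR-zero-≢ v≢x rewrite reach-zero-≢ v≢x = refl

  distR-zero-separates : ∀ {v y} → v ≢ y → distR G 0 v v ≢ distR G 0 v y
  distR-zero-separates {v} v≢y eq with () ← trans (sym (distR-zero-refl v)) (trans eq (distR-zero-≢ v≢y))

allButFirst-resolving₀ : ∀ {m} (G : Graph (suc m)) → Resolving G 0 (outside ∷ ⊤)
allButFirst-resolving₀ G Fin.zero    Fin.zero    x≢y = contradiction refl x≢y
allButFirst-resolving₀ G Fin.zero    (Fin.suc j) x≢y =
  Fin.suc j , there ∈⊤ , distR-zero-separates G (≢-sym x≢y) ∘ sym
allButFirst-resolving₀ G (Fin.suc i) _           x≢y = Fin.suc i , there ∈⊤ , distR-zero-separates G x≢y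

Twins : ∀ {n} → Graph n → ℕ → Fin n → Fin n → Set
Twins G r x y = ∀ v → v ≢ x → v ≢ y → distR G r v x ≡ distR G r v y

resolving-meets-twins : ∀ {n} (G : Graph n) r {S x y} → Resolving G r S → x ≢ y → Twins G r x y →
                        x ∈ S ⊎ y ∈ S
resolving-meets-twins G r {S} {x} {y} R x≢y twins with R x y x≢y
... | v , v∈S , separates = v-is-x-or-y v∈S (λ v≢x v≢y → separates (twins v v≢x v≢y))
  where
  v-is-x-or-y : ∀ {v} → v ∈ S → (v ≢ x → v ≢ y → ⊥) → x ∈ S ⊎ y ∈ S
  v-is-x-or-y {v} v∈S v∈xy with v ≟ x | v ≟ y
  ... | yes refl | _        = inj₁ v∈S
  ... | no _     | yes refl = inj₂ v∈S
  ... | no v≢x   | no v≢y   = ⊥-elim (v∈xy v≢x v≢y)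

twins₀ : ∀ {n} (G : Graph n) {x y} → Twins G 0 x y
twins₀ G v v≢x v≢y = trans (distR-zero-≢ G v≢x) (sym (distR-zero-≢ G v≢y))

∈-tail : ∀ {n} {S : Subset n} {x} → Fin.zero ∈ outside ∷ S ⊎ Fin.suc x ∈ outside ∷ S → x ∈ S
∈-tail (inj₂ sx∈S) = drop-there sx∈S

meets-all-pairs⇒n≤1+∣S∣ : ∀ {n} (S : Subset n) → (∀ x y → x ≢ y → x ∈ S ⊎ y ∈ S) → n ≤ suc ∣ S ∣
meets-all-pairs⇒n≤1+∣S∣ []            _     = z≤n
meets-all-pairs⇒n≤1+∣S∣ (inside ∷ S)  meets = s≤s (meets-all-pairs⇒n≤1+∣S∣ S λ x y x≢y →
  Sum.map drop-there drop-there (meets (Fin.suc x) (Fin.suc y) (x≢y ∘ suc-injective)))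
meets-all-pairs⇒n≤1+∣S∣ {suc n} (outside ∷ S) meets = s≤s (begin
  n          ≡⟨ sym (∣⊤∣≡n n) ⟩
  ∣ ⊤ {n} ∣  ≤⟨ p⊆q⇒∣p∣≤∣q∣ {p = ⊤} (λ {x} _ → ∈-tail (meets Fin.zero (Fin.suc x) λ ())) ⟩
  ∣ S ∣      ∎)
  where open ≤-Reasoning

meets-monochromatic-pairs⇒n≤2+∣S∣ : ∀ {n} (c : Fin n → Bool) (S : Subset n) →
  (∀ x y → x ≢ y → c x ≡ c y → x ∈ S ⊎ y ∈ S) → n ≤ 2 + ∣ S ∣
meets-monochromatic-pairs⇒n≤2+∣S∣ c []            _     = z≤n
meets-monochromatic-pairs⇒n≤2+∣S∣ c (inside ∷ S)  meets =
  s≤s (meets-monochromatic-pairs⇒n≤2+∣S∣ (c ∘ Fin.suc) S λ x y x≢y →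
    Sum.map drop-there drop-there ∘ meets (Fin.suc x) (Fin.suc y) (x≢y ∘ suc-injective))
meets-monochromatic-pairs⇒n≤2+∣S∣ c (outside ∷ S) meets = s≤s (meets-all-pairs⇒n≤1+∣S∣ S meets-tail)
  where
  -- every tail vertex coloured like the omitted head is in S; the rest are monochromatic
  meets-tail : ∀ x y → x ≢ y → x ∈ S ⊎ y ∈ S
  meets-tail x y x≢y with c (Fin.suc x) ≟ᵇ c Fin.zero | c (Fin.suc y) ≟ᵇ c Fin.zero
  ... | yes cx≡c0 | _         = inj₁ (∈-tail (meets Fin.zero (Fin.suc x) (λ ()) (sym cx≡c0)))
  ... | no _      | yes cy≡c0 = inj₂ (∈-tail (meets Fin.zero (Fin.suc y) (λ ()) (sym cy≡c0)))
  ... | no cx≢c0  | no cy≢c0  = Sum.map drop-there drop-there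
    (meets (Fin.suc x) (Fin.suc y) (x≢y ∘ suc-injective) (trans (¬-not cx≢c0) (sym (¬-not cy≢c0))))

module _ (s t : ℕ) where

  K-twins : ∀ x y → side {s} {t} x ≡ side {s} {t} y → ∀ z → K s t z x ≡ K s t z y
  K-twins x y same z with side {s} {t} z | side {s} {t} x | side {s} {t} y | same
  ... | _ | _ | _ | refl = refl

  K-adjacent : ∀ z x → side {s} {t} z ≢ side {s} {t} x → T (K s t z x)
  K-adjacent z x differ with side {s} {t} z | side {s} {t} x
  ... | true  | true  = contradiction refl differ
  ... | true  | false = _
  ... | false | true  = _
  ... | false | false = contradiction refl differ

side-↑ʳ : ∀ s t (j : Fin t) → side {s} {t} (s ↑ʳ j) ≡ false
side-↑ʳ s t j rewrite splitAt-↑ʳ s t j = refl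

module _ (s t : ℕ) where
  private
    G = K (suc s) (suc t)
    side⁺ = side {suc s} {suc t}

  opposite : ∀ v → Σ (Fin (suc s + suc t)) λ w → side⁺ w ≢ side⁺ v
  opposite v with side⁺ v
  ... | true  = suc s ↑ʳ Fin.zero , λ w-true →
                  case trans (sym (side-↑ʳ (suc s) (suc t) Fin.zero)) w-true of λ ()
  ... | false = Fin.zero , λ ()

  K-diameter-2 : ∀ v x → T (reach G 2 v x)
  K-diameter-2 v x with side⁺ v ≟ᵇ side⁺ x
  ... | no differ = reach-mono-suc G 1 v x (reach-step G 0 v v x (reach-refl G v) v~x)
    where v~x = K-adjacent (suc s) (suc t) v x differ
  ... | yes same with opposite v
  ...   | w , w≢v = reach-step G 1 v w x (reach-step G 0 v v w (reach-refl G v) v~w) w~x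
    where v~w = K-adjacent (suc s) (suc t) v w (≢-sym w≢v)
          w~x = K-adjacent (suc s) (suc t) w x λ w≡x → w≢v (trans w≡x (sym same))

  K-same-side-twins : ∀ r {x y} → side⁺ x ≡ side⁺ y → Twins G r x y
  K-same-side-twins r {x} {y} same v v≢x v≢y =
    distR-cong G (reach-twins G (K-twins (suc s) (suc t) x y same) v≢x v≢y) (K-diameter-2 v x) r

mainTheorem13 : (s t : ℕ) → 1 ≤ s → 1 ≤ t → ThDimIs (K s t) (s + t ∸ 1)
mainTheorem13 (suc s) (suc t) (s≤s z≤n) (s≤s z≤n) =
  (0 , outside ∷ ⊤ , allButFirst-resolving₀ G , ∣⊤∣≡n (s + suc t)) , lower
  where
  G = K (suc s) (suc t)
  lower : (r : ℕ) (S : Subset (suc s + suc t)) → Resolving G r S → s + suc t ≤ r + ∣ S ∣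
  lower zero    S R = ≤-pred (meets-all-pairs⇒n≤1+∣S∣ S λ x y x≢y →
    resolving-meets-twins G 0 R x≢y (twins₀ G))
  lower (suc r) S R = ≤-trans
    (≤-pred (meets-monochromatic-pairs⇒n≤2+∣S∣ (side {suc s} {suc t}) S λ x y x≢y same →
      resolving-meets-twins G (suc r) R x≢y (K-same-side-twins s t (suc r) same)))
    (s≤s (m≤n+m ∣ S ∣ r))
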